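{- Let $p\ge 1$ be an integer, let $G$ be a graph, and let $A$ be a $p$-rock of $G$. Then every vertex $v\in V(G)\setminus A$ has at most $2p+1$ neighbours in $A$.
   Context: Graphs are finite and simple; $G[A]$ denotes the subgraph induced on $A\subseteq V(G)$. For an integer $p\ge 1$, a $p$-rock of $G$ is a set $A\subseteq V(G)$ such that: (i) $A\neq\emptyset$ and $|E(G[A])|\ge p|A|$; (ii) subject to (i), $|A|$ is minimum; and (iii) subject to (i) and (ii), $|E(G[A])|$ is maximum. -}

module Defs where

open import Data.Nat using (ℕ; zero; suc; _+_; _*_; _≤_; _<_; _<ᵇ_)
open import Data.Bool using (Bool; true; false; _∧_; T)
open import Data.Fin using (Fin; toℕ)
open import Data.Fin.Subset using (Subset; _∈_; _∉_; ∣_∣; Nonempty)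
open import Data.List using (List; map; allFin)
open import Data.Nat.ListAction using (sum)
open import Data.Vec using (lookup)
open import Data.Product using (_×_)
open import Relation.Binary.PropositionalEquality using (_≡_)

record Graph (n : ℕ) : Set where
  field
    adj    : Fin n → Fin n → Bool
    sym    : ∀ u v → adj u v ≡ adj v u
    irrefl : ∀ v → adj v v ≡ false

open Graph public

𝟙 : Bool → ℕ
𝟙 true  = 1
𝟙 false = 0

∑ : {n : ℕ} → (Fin n → ℕ) → ℕ
∑ {n} f = sum (map f (allFin n))

-- number of edges of the induced subgraph G[A]:
-- unordered pairs {u,v} with toℕ u < toℕ v, both in A, adjacent.
edgesIn : {n : ℕ} → Graph n → Subset n → ℕ
edgesIn {n} G A =
  ∑ λ u → ∑ λ v →
    𝟙 (lookup A u ∧ lookup A v ∧ adj G u v ∧ (toℕ u <ᵇ toℕ v))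

nbrsIn : {n : ℕ} → Graph n → Subset n → Fin n → ℕ
nbrsIn G A v = ∑ λ u → 𝟙 (lookup A u ∧ adj G v u)

Dense : {n : ℕ} → ℕ → Graph n → Subset n → Set
Dense p G A = Nonempty A × (p * ∣ A ∣ ≤ edgesIn G A)

IsRock : {n : ℕ} → ℕ → Graph n → Subset n → Set
IsRock {n} p G A =
  Dense p G A
  × (∀ (B : Subset n) → Dense p G B → ∣ A ∣ ≤ ∣ B ∣)
  × (∀ (B : Subset n) → Dense p G B → ∣ B ∣ ≡ ∣ A ∣ → edgesIn G B ≤ edgesIn G A)

-- Let u be a vertex of minimum degree δ in G[A] and B = A − u. Since a dense set has at
-- least 2p ≥ 2 vertices, B is nonempty, so minimality of |A| gives e(B) < p|B|; on the other
-- hand |A|δ ≤ 2e(A) = 2(e(B) + δ), and together with δ ≤ |B| this forces δ ≤ 2p. Maximality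
-- of e(A) among dense sets of size |A| says that exchanging u for a vertex v ∉ A does not
-- increase the number of edges, so v has at most δ neighbours in B and at most δ + 1 in A.
module Submission where

open import Defs
open import Data.Nat using (ℕ; zero; suc; _+_; _*_; _≤_; _<_; _<ᵇ_; z≤n; >-nonZero)
open import Data.Nat.Properties
open import Data.Product as Product using (_,_; _×_; ∃-syntax; proj₁; proj₂)
open import Data.Bool using (Bool; true; false; _∧_)
open import Data.Empty using (⊥-elim)
open import Data.Fin using (Fin; zero; suc; toℕ; punchIn)
open import Data.Fin.Properties using (punchInᵢ≢i; toℕ-injective)
open import Data.Fin.Subset using (Subset; ∣_∣; _∈_; _∉_; _⊆_; Nonempty)
open import Data.Fin.Subset.Properties using (x∈p⇒∣p-x∣<∣p∣; _∈?_)
import Data.List as List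
open import Data.List using (allFin)
open import Data.List.Extrema.Nat using (argmin; argmin-all; f[argmin]≤f[xs])
import Data.List.Relation.Unary.All as All
open import Data.List.Relation.Unary.All.Properties using (all-filter)
open import Data.List.Membership.Propositional.Properties using (∈-filter⁺; ∈-allFin)
open import Data.Nat.ListAction using () renaming (sum to sumᴸ)
open import Data.List.Properties using (map-tabulate)
open import Data.Vec using ([]; _∷_; lookup; _[_]≔_; here; there)
open import Data.Vec.Properties
  using (lookup∘updateAt; lookup∘updateAt′; []≔-lookup; []≔-updates; []=⇒lookup; lookup⇒[]=)
open import Data.Vec.Functional using (removeAt)
open import Algebra.Properties.Semiring.Sum +-*-semiring
  using (sum; sum-cong-≗; sum-remove; ∑-distrib-+; ∑-comm; *-distribˡ-sum; *-distribʳ-sum)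
open import Function using (id; _∘_)
open import Relation.Nullary using (contradiction; ofʸ; ofⁿ)
open import Relation.Binary.PropositionalEquality
  using (_≡_; _≢_; refl; cong; cong₂; trans; subst; subst₂; module ≡-Reasoning)
import Relation.Binary.PropositionalEquality as ≡
open import Data.Nat.Tactic.RingSolver using (solve-∀)

sum-tabulate : ∀ {n} (f : Fin n → ℕ) → sumᴸ (List.tabulate f) ≡ sum f
sum-tabulate {zero}  f = refl
sum-tabulate {suc n} f = cong (f zero +_) (sum-tabulate (f ∘ suc))

∑≡sum : ∀ {n} (f : Fin n → ℕ) → ∑ f ≡ sum f
∑≡sum f = trans (cong sumᴸ (map-tabulate id f)) (sum-tabulate f)

sum-mono-≤ : ∀ {n} {f g : Fin n → ℕ} → (∀ i → f i ≤ g i) → sum f ≤ sum g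
sum-mono-≤ {zero}  f≤g = z≤n
sum-mono-≤ {suc n} f≤g = +-mono-≤ (f≤g zero) (sum-mono-≤ (f≤g ∘ suc))

sum-≗-except : ∀ {n} {f g : Fin n → ℕ} (x : Fin n) → (∀ w → w ≢ x → f w ≡ g w) →
               sum f + g x ≡ sum g + f x
sum-≗-except {suc n} {f} {g} x f≗g = begin
  sum f + g x                      ≡⟨ cong (_+ g x) (sum-remove {i = x} f) ⟩
  (f x + sum (removeAt f x)) + g x ≡⟨ cong (λ s → (f x + s) + g x) rest ⟩
  (f x + sum (removeAt g x)) + g x ≡⟨ swap (f x) (sum (removeAt g x)) (g x) ⟩
  (g x + sum (removeAt g x)) + f x ≡⟨ cong (_+ f x) (sum-remove {i = x} g) ⟨
  sum g + f x                      ∎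
  where
  open ≡-Reasoning
  rest : sum (removeAt f x) ≡ sum (removeAt g x)
  rest = sum-cong-≗ (λ j → f≗g (punchIn x j) (punchInᵢ≢i x j))
  swap : ∀ a s b → (a + s) + b ≡ (b + s) + a
  swap = solve-∀

sum-[]≔true : ∀ {n} (X : Subset n) (x : Fin n) (h : Bool → Fin n → ℕ) → h false x ≡ 0 →
              sum (λ w → h (lookup (X [ x ]≔ true) w) w)
                ≡ sum (λ w → h (lookup (X [ x ]≔ false) w) w) + h true x
sum-[]≔true X x h h0 = begin
  sum h⟨ true ⟩                  ≡⟨ +-identityʳ _ ⟨
  sum h⟨ true ⟩ + 0              ≡⟨ cong (sum h⟨ true ⟩ +_) (trans (≡.sym h0) (≡.sym (at-x false))) ⟩
  sum h⟨ true ⟩ + h⟨ false ⟩ x   ≡⟨ sum-≗-except x off-x ⟩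
  sum h⟨ false ⟩ + h⟨ true ⟩ x   ≡⟨ cong (sum h⟨ false ⟩ +_) (at-x true) ⟩
  sum h⟨ false ⟩ + h true x      ∎
  where
  open ≡-Reasoning
  h⟨_⟩ : Bool → Fin _ → ℕ
  h⟨ b ⟩ w = h (lookup (X [ x ]≔ b) w) w
  at-x : ∀ b → h⟨ b ⟩ x ≡ h b x
  at-x b = cong (λ c → h c x) (lookup∘updateAt x X)
  off-x : ∀ w → w ≢ x → h⟨ true ⟩ w ≡ h⟨ false ⟩ w
  off-x w w≢x = cong (λ b → h b w)
    (trans (lookup∘updateAt′ w x w≢x X) (≡.sym (lookup∘updateAt′ w x w≢x X)))

∣∣≡sum : ∀ {n} (X : Subset n) → ∣ X ∣ ≡ sum (λ w → 𝟙 (lookup X w))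
∣∣≡sum []          = refl
∣∣≡sum (true ∷ X)  = cong suc (∣∣≡sum X)
∣∣≡sum (false ∷ X) = ∣∣≡sum X

∣[]≔true∣ : ∀ {n} (X : Subset n) (x : Fin n) → ∣ X [ x ]≔ true ∣ ≡ ∣ X [ x ]≔ false ∣ + 1
∣[]≔true∣ X x = begin
  ∣ X [ x ]≔ true ∣                                    ≡⟨ ∣∣≡sum (X [ x ]≔ true) ⟩
  sum (λ w → 𝟙 (lookup (X [ x ]≔ true) w))             ≡⟨ sum-[]≔true X x (λ b _ → 𝟙 b) refl ⟩
  sum (λ w → 𝟙 (lookup (X [ x ]≔ false) w)) + 1       ≡⟨ cong (_+ 1) (∣∣≡sum (X [ x ]≔ false)) ⟨
  ∣ X [ x ]≔ false ∣ + 1                               ∎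
  where open ≡-Reasoning

0<∣∣⇒Nonempty : ∀ {n} (X : Subset n) → 0 < ∣ X ∣ → Nonempty X
0<∣∣⇒Nonempty (true  ∷ X) _      = zero , here
0<∣∣⇒Nonempty (false ∷ X) 0<∣X∣ = Product.map suc there (0<∣∣⇒Nonempty X 0<∣X∣)

∉⇒lookup≡false : ∀ {n} {X : Subset n} {x} → x ∉ X → lookup X x ≡ false
∉⇒lookup≡false {X = X} {x} x∉X with lookup X x in eq
... | true  = contradiction (lookup⇒[]= x X eq) x∉X
... | false = refl

[]≔-∈ : ∀ {n} {X : Subset n} {x} → x ∈ X → X [ x ]≔ true ≡ X
[]≔-∈ {X = X} {x} x∈X = trans (cong (X [ x ]≔_) (≡.sym ([]=⇒lookup x∈X))) ([]≔-lookup X x)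

[]≔-∉ : ∀ {n} {X : Subset n} {x} → x ∉ X → X [ x ]≔ false ≡ X
[]≔-∉ {X = X} {x} x∉X = trans (cong (X [ x ]≔_) (≡.sym (∉⇒lookup≡false x∉X))) ([]≔-lookup X x)

[]≔false-⊆ : ∀ {n} (X : Subset n) x → X [ x ]≔ false ⊆ X
[]≔false-⊆ (_ ∷ X) zero    (there y∈X) = there y∈X
[]≔false-⊆ (_ ∷ X) (suc x) here        = here
[]≔false-⊆ (_ ∷ X) (suc x) (there y∈X) = there ([]≔false-⊆ X x y∈X)

∣∣-delete : ∀ {n} {X : Subset n} {x} → x ∈ X → ∣ X ∣ ≡ ∣ X [ x ]≔ false ∣ + 1
∣∣-delete {X = X} {x} x∈X =
  subst (λ Y → ∣ Y ∣ ≡ ∣ X [ x ]≔ false ∣ + 1) ([]≔-∈ x∈X) (∣[]≔true∣ X x)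

∣∣-insert : ∀ {n} {X : Subset n} {x} → x ∉ X → ∣ X [ x ]≔ true ∣ ≡ ∣ X ∣ + 1
∣∣-insert {X = X} {x} x∉X =
  subst (λ Y → ∣ X [ x ]≔ true ∣ ≡ ∣ Y ∣ + 1) ([]≔-∉ x∉X) (∣[]≔true∣ X x)

∃-argmin : ∀ {n} (X : Subset n) (f : Fin n → ℕ) → Nonempty X →
           ∃[ u ] u ∈ X × (∀ {w} → w ∈ X → f u ≤ f w)
∃-argmin X f (x , x∈X) = argmin f x xs , argmin-all f x∈X (all-filter (_∈? X) (allFin _)) , minimal
  where
  xs : List.List (Fin _)
  xs = List.filter (_∈? X) (allFin _)
  minimal : ∀ {w} → w ∈ X → f (argmin f x xs) ≤ f w
  minimal w∈X = All.lookup (f[argmin]≤f[xs] x xs) (∈-filter⁺ (_∈? X) (∈-allFin _) w∈X)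

𝟙-∧ : ∀ a b → 𝟙 (a ∧ b) ≡ 𝟙 a * 𝟙 b
𝟙-∧ true  true  = refl
𝟙-∧ true  false = refl
𝟙-∧ false _     = refl

𝟙≤1 : ∀ b → 𝟙 b ≤ 1
𝟙≤1 true  = ≤-refl
𝟙≤1 false = z≤n

module _ {n : ℕ} (G : Graph n) where

  adj⇒≢ : ∀ {u w} → adj G u w ≡ true → u ≢ w
  adj⇒≢ {u} u~w refl = contradiction (trans (≡.sym u~w) (irrefl G u)) λ ()

  nbrsIn≡sum : ∀ (X : Subset n) y → nbrsIn G X y ≡ sum (λ w → 𝟙 (lookup X w ∧ adj G y w))
  nbrsIn≡sum X y = ∑≡sum (λ w → 𝟙 (lookup X w ∧ adj G y w))

  edgesIn≡sum : ∀ (X : Subset n) → edgesIn G X ≡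
    sum (λ u → sum (λ w → 𝟙 (lookup X u ∧ lookup X w ∧ adj G u w ∧ (toℕ u <ᵇ toℕ w))))
  edgesIn≡sum X = trans (∑≡sum (λ u → ∑ (edge u))) (sum-cong-≗ (λ u → ∑≡sum (edge u)))
    where
    edge : Fin n → Fin n → ℕ
    edge u w = 𝟙 (lookup X u ∧ lookup X w ∧ adj G u w ∧ (toℕ u <ᵇ toℕ w))

  nbrsIn-[]≔true : ∀ (X : Subset n) x y →
    nbrsIn G (X [ x ]≔ true) y ≡ nbrsIn G (X [ x ]≔ false) y + 𝟙 (adj G y x)
  nbrsIn-[]≔true X x y = begin
    nbrsIn G (X [ x ]≔ true) y                           ≡⟨ nbrsIn≡sum (X [ x ]≔ true) y ⟩
    sum (λ w → 𝟙 (lookup (X [ x ]≔ true) w ∧ adj G y w)) ≡⟨ sum-[]≔true X x (λ b w → 𝟙 (b ∧ adj G y w)) refl ⟩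
    sum (λ w → 𝟙 (lookup (X [ x ]≔ false) w ∧ adj G y w)) + 𝟙 (adj G y x)
                                                          ≡⟨ cong (_+ 𝟙 (adj G y x)) (nbrsIn≡sum (X [ x ]≔ false) y) ⟨
    nbrsIn G (X [ x ]≔ false) y + 𝟙 (adj G y x)          ∎
    where open ≡-Reasoning

  nbrsIn-[]≔true-self : ∀ (X : Subset n) x → nbrsIn G (X [ x ]≔ true) x ≡ nbrsIn G (X [ x ]≔ false) x
  nbrsIn-[]≔true-self X x = begin
    nbrsIn G (X [ x ]≔ true) x                  ≡⟨ nbrsIn-[]≔true X x x ⟩
    nbrsIn G (X [ x ]≔ false) x + 𝟙 (adj G x x) ≡⟨ cong (λ b → nbrsIn G (X [ x ]≔ false) x + 𝟙 b) (irrefl G x) ⟩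
    nbrsIn G (X [ x ]≔ false) x + 0             ≡⟨ +-identityʳ (nbrsIn G (X [ x ]≔ false) x) ⟩
    nbrsIn G (X [ x ]≔ false) x                 ∎
    where open ≡-Reasoning

  nbrsIn≤∣∣ : ∀ (X : Subset n) y → nbrsIn G X y ≤ ∣ X ∣
  nbrsIn≤∣∣ X y = begin
    nbrsIn G X y                           ≡⟨ nbrsIn≡sum X y ⟩
    sum (λ w → 𝟙 (lookup X w ∧ adj G y w)) ≤⟨ sum-mono-≤ (λ w → 𝟙-∧-≤ (lookup X w) (adj G y w)) ⟩
    sum (λ w → 𝟙 (lookup X w))             ≡⟨ ∣∣≡sum X ⟨
    ∣ X ∣                                  ∎
    where
    open ≤-Reasoning
    𝟙-∧-≤ : ∀ a b → 𝟙 (a ∧ b) ≤ 𝟙 a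
    𝟙-∧-≤ true  true  = ≤-refl
    𝟙-∧-≤ true  false = z≤n
    𝟙-∧-≤ false _     = z≤n

  𝟙-adj-split : ∀ u w →
    𝟙 (adj G u w) ≡ 𝟙 (adj G u w ∧ (toℕ u <ᵇ toℕ w)) + 𝟙 (adj G w u ∧ (toℕ w <ᵇ toℕ u))
  𝟙-adj-split u w rewrite Graph.sym G w u with adj G u w in u~w
  ... | false = refl
  ... | true with toℕ u <ᵇ toℕ w | <ᵇ-reflects-< (toℕ u) (toℕ w)
                | toℕ w <ᵇ toℕ u | <ᵇ-reflects-< (toℕ w) (toℕ u)
  ... | true  | ofʸ _   | false | ofⁿ _   = refl
  ... | false | ofⁿ _   | true  | ofʸ _   = refl
  ... | true  | ofʸ u<w | true  | ofʸ w<u = ⊥-elim (<-asym u<w w<u)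
  ... | false | ofⁿ u≮w | false | ofⁿ w≮u =
    contradiction (toℕ-injective (≤-antisym (≮⇒≥ w≮u) (≮⇒≥ u≮w))) (adj⇒≢ u~w)

  handshake : ∀ (X : Subset n) → sum (λ u → 𝟙 (lookup X u) * nbrsIn G X u) ≡ 2 * edgesIn G X
  handshake X = begin
    sum (λ u → 𝟙 (lookup X u) * nbrsIn G X u)       ≡⟨ sum-cong-≗ row ⟩
    sum (λ u → sum (λ w → edge u w + edge w u))      ≡⟨ sum-cong-≗ (λ u → ∑-distrib-+ (edge u) (λ w → edge w u)) ⟩
    sum (λ u → sum (edge u) + sum (λ w → edge w u))  ≡⟨ ∑-distrib-+ (λ u → sum (edge u)) (λ u → sum (λ w → edge w u)) ⟩
    E + sum (λ u → sum (λ w → edge w u))             ≡⟨ cong (E +_) (∑-comm (λ u w → edge w u)) ⟩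
    E + E                                            ≡⟨ cong (E +_) (+-identityʳ E) ⟨
    2 * E                                            ≡⟨ cong (2 *_) (edgesIn≡sum X) ⟨
    2 * edgesIn G X                                  ∎
    where
    open ≡-Reasoning
    edge : Fin n → Fin n → ℕ
    edge u w = 𝟙 (lookup X u ∧ lookup X w ∧ adj G u w ∧ (toℕ u <ᵇ toℕ w))
    E : ℕ
    E = sum (λ u → sum (edge u))
    split : ∀ a b u w → 𝟙 a * 𝟙 (b ∧ adj G u w)
      ≡ 𝟙 (a ∧ b ∧ adj G u w ∧ (toℕ u <ᵇ toℕ w)) + 𝟙 (b ∧ a ∧ adj G w u ∧ (toℕ w <ᵇ toℕ u))
    split true  true  u w = trans (*-identityˡ _) (𝟙-adj-split u w)
    split true  false _ _ = refl
    split false true  _ _ = refl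
    split false false _ _ = refl
    row : ∀ u → 𝟙 (lookup X u) * nbrsIn G X u ≡ sum (λ w → edge u w + edge w u)
    row u = begin
      𝟙 (lookup X u) * nbrsIn G X u                         ≡⟨ cong (𝟙 (lookup X u) *_) (nbrsIn≡sum X u) ⟩
      𝟙 (lookup X u) * sum (λ w → 𝟙 (lookup X w ∧ adj G u w)) ≡⟨ *-distribˡ-sum (𝟙 (lookup X u)) (λ w → 𝟙 (lookup X w ∧ adj G u w)) ⟩
      sum (λ w → 𝟙 (lookup X u) * 𝟙 (lookup X w ∧ adj G u w)) ≡⟨ sum-cong-≗ (λ w → split (lookup X u) (lookup X w) u w) ⟩
      sum (λ w → edge u w + edge w u)                        ∎

  -- Doubled, so that the handshake identity replaces the ordered pairs by degrees.
  edgesIn-[]≔true : ∀ (X : Subset n) x →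
    edgesIn G (X [ x ]≔ true) ≡ edgesIn G (X [ x ]≔ false) + nbrsIn G (X [ x ]≔ false) x
  edgesIn-[]≔true X x = *-cancelˡ-≡ _ _ 2 (begin
    2 * edgesIn G X⁺                                      ≡⟨ handshake X⁺ ⟨
    sum (λ u → χ⁺ u * nbrsIn G X⁺ u)                      ≡⟨ sum-cong-≗ split ⟩
    sum (λ u → χ⁺ u * d⁻ u + χ⁺ u * 𝟙 (adj G u x))        ≡⟨ ∑-distrib-+ (λ u → χ⁺ u * d⁻ u) (λ u → χ⁺ u * 𝟙 (adj G u x)) ⟩
    sum (λ u → χ⁺ u * d⁻ u) + sum (λ u → χ⁺ u * 𝟙 (adj G u x))
                          ≡⟨ cong₂ _+_ (sum-[]≔true X x (λ b u → 𝟙 b * d⁻ u) refl) neighbours-of-x ⟩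
    (sum (λ u → χ⁻ u * d⁻ u) + 1 * d⁻ x) + d⁻ x           ≡⟨ cong (λ s → (s + 1 * d⁻ x) + d⁻ x) (handshake X⁻) ⟩
    (2 * edgesIn G X⁻ + 1 * d⁻ x) + d⁻ x                  ≡⟨ regroup (edgesIn G X⁻) (d⁻ x) ⟩
    2 * (edgesIn G X⁻ + d⁻ x)                              ∎)
    where
    open ≡-Reasoning
    X⁺ X⁻ : Subset n
    X⁺ = X [ x ]≔ true
    X⁻ = X [ x ]≔ false
    χ⁺ χ⁻ d⁻ : Fin n → ℕ
    χ⁺ u = 𝟙 (lookup X⁺ u)
    χ⁻ u = 𝟙 (lookup X⁻ u)
    d⁻ = nbrsIn G X⁻
    split : ∀ u → χ⁺ u * nbrsIn G X⁺ u ≡ χ⁺ u * d⁻ u + χ⁺ u * 𝟙 (adj G u x)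
    split u = trans (cong (χ⁺ u *_) (nbrsIn-[]≔true X x u)) (*-distribˡ-+ (χ⁺ u) (d⁻ u) _)
    neighbours-of-x : sum (λ u → χ⁺ u * 𝟙 (adj G u x)) ≡ d⁻ x
    neighbours-of-x = begin
      sum (λ u → χ⁺ u * 𝟙 (adj G u x))          ≡⟨ sum-cong-≗ (λ u → cong (λ b → χ⁺ u * 𝟙 b) (Graph.sym G u x)) ⟩
      sum (λ u → χ⁺ u * 𝟙 (adj G x u))          ≡⟨ sum-cong-≗ (λ u → 𝟙-∧ (lookup X⁺ u) (adj G x u)) ⟨
      sum (λ u → 𝟙 (lookup X⁺ u ∧ adj G x u))   ≡⟨ nbrsIn≡sum X⁺ x ⟨
      nbrsIn G X⁺ x                             ≡⟨ nbrsIn-[]≔true-self X x ⟩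
      d⁻ x                                      ∎
    regroup : ∀ e d → (2 * e + 1 * d) + d ≡ 2 * (e + d)
    regroup = solve-∀

  2*edgesIn≤∣∣*∣∣ : ∀ (X : Subset n) → 2 * edgesIn G X ≤ ∣ X ∣ * ∣ X ∣
  2*edgesIn≤∣∣*∣∣ X = begin
    2 * edgesIn G X                           ≡⟨ handshake X ⟨
    sum (λ u → 𝟙 (lookup X u) * nbrsIn G X u) ≤⟨ sum-mono-≤ (λ u → *-monoʳ-≤ (𝟙 (lookup X u)) (nbrsIn≤∣∣ X u)) ⟩
    sum (λ u → 𝟙 (lookup X u) * ∣ X ∣)        ≡⟨ *-distribʳ-sum ∣ X ∣ (λ u → 𝟙 (lookup X u)) ⟨
    sum (λ u → 𝟙 (lookup X u)) * ∣ X ∣        ≡⟨ cong (_* ∣ X ∣) (∣∣≡sum X) ⟨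
    ∣ X ∣ * ∣ X ∣                             ∎
    where open ≤-Reasoning

  dense⇒2p≤∣∣ : ∀ p {X : Subset n} → Dense p G X → 2 * p ≤ ∣ X ∣
  dense⇒2p≤∣∣ p {X} ((x , x∈X) , p∣X∣≤e) = *-cancelʳ-≤ (2 * p) ∣ X ∣ ∣ X ∣ {{>-nonZero 0<∣X∣}} (begin
    2 * p * ∣ X ∣   ≡⟨ *-assoc 2 p ∣ X ∣ ⟩
    2 * (p * ∣ X ∣) ≤⟨ *-monoʳ-≤ 2 p∣X∣≤e ⟩
    2 * edgesIn G X ≤⟨ 2*edgesIn≤∣∣*∣∣ X ⟩
    ∣ X ∣ * ∣ X ∣   ∎)
    where
    open ≤-Reasoning
    0<∣X∣ : 0 < ∣ X ∣
    0<∣X∣ = ≤-<-trans z≤n (x∈p⇒∣p-x∣<∣p∣ x∈X)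

  ∣∣*minDegree≤2*edgesIn : ∀ {X : Subset n} {u} → (∀ {w} → w ∈ X → nbrsIn G X u ≤ nbrsIn G X w) →
                            ∣ X ∣ * nbrsIn G X u ≤ 2 * edgesIn G X
  ∣∣*minDegree≤2*edgesIn {X} {u} minimal = begin
    ∣ X ∣ * δ                                  ≡⟨ cong (_* δ) (∣∣≡sum X) ⟩
    sum (λ w → 𝟙 (lookup X w)) * δ             ≡⟨ *-distribʳ-sum δ (λ w → 𝟙 (lookup X w)) ⟩
    sum (λ w → 𝟙 (lookup X w) * δ)             ≤⟨ sum-mono-≤ pointwise ⟩
    sum (λ w → 𝟙 (lookup X w) * nbrsIn G X w)  ≡⟨ handshake X ⟩
    2 * edgesIn G X                            ∎
    where
    open ≤-Reasoning
    δ : ℕ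
    δ = nbrsIn G X u
    pointwise : ∀ w → 𝟙 (lookup X w) * δ ≤ 𝟙 (lookup X w) * nbrsIn G X w
    pointwise w with lookup X w in w∈X
    ... | true  = *-monoʳ-≤ 1 (minimal (lookup⇒[]= w X w∈X))
    ... | false = z≤n

module _ {n : ℕ} (G : Graph n) {X : Subset n} {x : Fin n} where

  nbrsIn-delete : x ∈ X → ∀ y → nbrsIn G X y ≡ nbrsIn G (X [ x ]≔ false) y + 𝟙 (adj G y x)
  nbrsIn-delete x∈X y =
    subst (λ Y → nbrsIn G Y y ≡ nbrsIn G (X [ x ]≔ false) y + 𝟙 (adj G y x))
          ([]≔-∈ x∈X) (nbrsIn-[]≔true G X x y)

  nbrsIn≤∣∣-delete : x ∈ X → nbrsIn G X x ≤ ∣ X [ x ]≔ false ∣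
  nbrsIn≤∣∣-delete x∈X =
    subst (λ Y → nbrsIn G Y x ≤ ∣ X [ x ]≔ false ∣) ([]≔-∈ x∈X)
          (≤-trans (≤-reflexive (nbrsIn-[]≔true-self G X x)) (nbrsIn≤∣∣ G (X [ x ]≔ false) x))

  edgesIn-delete : x ∈ X → edgesIn G X ≡ edgesIn G (X [ x ]≔ false) + nbrsIn G X x
  edgesIn-delete x∈X =
    subst (λ Y → edgesIn G Y ≡ edgesIn G (X [ x ]≔ false) + nbrsIn G Y x) ([]≔-∈ x∈X)
          (trans (edgesIn-[]≔true G X x)
                 (cong (edgesIn G (X [ x ]≔ false) +_) (≡.sym (nbrsIn-[]≔true-self G X x))))

  edgesIn-insert : x ∉ X → edgesIn G (X [ x ]≔ true) ≡ edgesIn G X + nbrsIn G X x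
  edgesIn-insert x∉X =
    subst (λ Y → edgesIn G (X [ x ]≔ true) ≡ edgesIn G Y + nbrsIn G Y x) ([]≔-∉ x∉X)
          (edgesIn-[]≔true G X x)

minDegree-bound : ∀ m e δ p → (m + 1) * δ ≤ 2 * (e + δ) → e < p * m → δ ≤ m → δ ≤ 2 * p
minDegree-bound m e δ p avg sparse δ≤m = m<1+n⇒m≤n (*-cancelˡ-< m δ (suc (2 * p)) (begin-strict
  m * δ           ≤⟨ +-cancelʳ-≤ δ (m * δ) (2 * e + δ) (subst₂ _≤_ (lhs m δ) (rhs e δ) avg) ⟩
  2 * e + δ       <⟨ +-mono-<-≤ (*-monoʳ-< 2 sparse) δ≤m ⟩
  2 * (p * m) + m ≡⟨ total p m ⟩
  m * suc (2 * p) ∎))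
  where
  open ≤-Reasoning
  lhs : ∀ m δ → (m + 1) * δ ≡ m * δ + δ
  lhs = solve-∀
  rhs : ∀ e δ → 2 * (e + δ) ≡ (2 * e + δ) + δ
  rhs = solve-∀
  total : ∀ p m → 2 * (p * m) + m ≡ m * suc (2 * p)
  total = solve-∀

module _ {n : ℕ} (p : ℕ) (G : Graph n) {A : Subset n} (rock : IsRock p G A) where

  private
    A-dense : Dense p G A
    A-dense = proj₁ rock
    ∣A∣-minimal : ∀ B → Dense p G B → ∣ A ∣ ≤ ∣ B ∣
    ∣A∣-minimal = proj₁ (proj₂ rock)
    edgesIn-maximal : ∀ B → Dense p G B → ∣ B ∣ ≡ ∣ A ∣ → edgesIn G B ≤ edgesIn G A
    edgesIn-maximal = proj₂ (proj₂ rock)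

  rock-delete-sparse : 1 ≤ p → ∀ {u} → u ∈ A → edgesIn G (A [ u ]≔ false) < p * ∣ A [ u ]≔ false ∣
  rock-delete-sparse 1≤p {u} u∈A = ≰⇒> λ B-dense →
    <⇒≱ ∣B∣<∣A∣ (∣A∣-minimal B (0<∣∣⇒Nonempty B 0<∣B∣ , B-dense))
    where
    open ≤-Reasoning
    B : Subset n
    B = A [ u ]≔ false
    ∣B∣<∣A∣ : ∣ B ∣ < ∣ A ∣
    ∣B∣<∣A∣ = ≤-reflexive (≡.sym (trans (∣∣-delete u∈A) (+-comm ∣ B ∣ 1)))
    0<∣B∣ : 0 < ∣ B ∣
    0<∣B∣ = +-cancelʳ-≤ 1 1 ∣ B ∣ (begin
      2          ≤⟨ *-monoʳ-≤ 2 1≤p ⟩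
      2 * p      ≤⟨ dense⇒2p≤∣∣ G p A-dense ⟩
      ∣ A ∣      ≡⟨ ∣∣-delete u∈A ⟩
      ∣ B ∣ + 1  ∎)

  rock-minDegree≤2p : 1 ≤ p → ∀ {u} → u ∈ A → (∀ {w} → w ∈ A → nbrsIn G A u ≤ nbrsIn G A w) →
                      nbrsIn G A u ≤ 2 * p
  rock-minDegree≤2p 1≤p {u} u∈A minimal =
    minDegree-bound ∣ B ∣ (edgesIn G B) δ p average (rock-delete-sparse 1≤p u∈A) (nbrsIn≤∣∣-delete G u∈A)
    where
    open ≤-Reasoning
    B : Subset n
    B = A [ u ]≔ false
    δ : ℕ
    δ = nbrsIn G A u
    average : (∣ B ∣ + 1) * δ ≤ 2 * (edgesIn G B + δ)
    average = begin
      (∣ B ∣ + 1) * δ        ≡⟨ cong (_* δ) (∣∣-delete u∈A) ⟨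
      ∣ A ∣ * δ              ≤⟨ ∣∣*minDegree≤2*edgesIn G minimal ⟩
      2 * edgesIn G A        ≡⟨ cong (2 *_) (edgesIn-delete G u∈A) ⟩
      2 * (edgesIn G B + δ)  ∎

  rock-exchange : ∀ {u v} → u ∈ A → v ∉ A → nbrsIn G (A [ u ]≔ false) v ≤ nbrsIn G A u
  rock-exchange {u} {v} u∈A v∉A = ≮⇒≥ λ δ<d →
    <⇒≱ (more-edges δ<d) (edgesIn-maximal A′ (A′-dense δ<d) ∣A′∣≡∣A∣)
    where
    B A′ : Subset n
    B  = A [ u ]≔ false
    A′ = B [ v ]≔ true
    v∉B : v ∉ B
    v∉B = v∉A ∘ []≔false-⊆ A u
    ∣A′∣≡∣A∣ : ∣ A′ ∣ ≡ ∣ A ∣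
    ∣A′∣≡∣A∣ = trans (∣∣-insert v∉B) (≡.sym (∣∣-delete u∈A))
    more-edges : nbrsIn G A u < nbrsIn G B v → edgesIn G A < edgesIn G A′
    more-edges δ<d = begin-strict
      edgesIn G A                  ≡⟨ edgesIn-delete G u∈A ⟩
      edgesIn G B + nbrsIn G A u   <⟨ +-monoʳ-< (edgesIn G B) δ<d ⟩
      edgesIn G B + nbrsIn G B v   ≡⟨ edgesIn-insert G v∉B ⟨
      edgesIn G A′                 ∎
      where open ≤-Reasoning
    A′-dense : nbrsIn G A u < nbrsIn G B v → Dense p G A′
    A′-dense δ<d = (v , []≔-updates B v) , (begin
      p * ∣ A′ ∣   ≡⟨ cong (p *_) ∣A′∣≡∣A∣ ⟩
      p * ∣ A ∣    ≤⟨ proj₂ A-dense ⟩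
      edgesIn G A  ≤⟨ <⇒≤ (more-edges δ<d) ⟩
      edgesIn G A′ ∎)
      where open ≤-Reasoning

mainTheorem3 : (p : ℕ) → 1 ≤ p → (n : ℕ) → (G : Graph n) → (A : Subset n)
               → IsRock p G A → (v : Fin n) → v ∉ A
               → nbrsIn G A v ≤ 2 * p + 1
mainTheorem3 p 1≤p n G A rock v v∉A with ∃-argmin A (nbrsIn G A) (proj₁ (proj₁ rock))
... | u , u∈A , u-minimal = begin
  nbrsIn G A v                                   ≡⟨ nbrsIn-delete G u∈A v ⟩
  nbrsIn G (A [ u ]≔ false) v + 𝟙 (adj G v u)   ≤⟨ +-mono-≤ (rock-exchange p G rock u∈A v∉A) (𝟙≤1 (adj G v u)) ⟩
  nbrsIn G A u + 1                               ≤⟨ +-monoˡ-≤ 1 (rock-minDegree≤2p p G rock 1≤p u∈A u-minimal) ⟩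
  2 * p + 1                                      ∎
  where open ≤-Reasoning
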